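{- In the calculus $\mathsf{G}$, for all formulas $\alpha,\beta,\gamma,\alpha_1,\alpha_2,\beta_1,\beta_2$: (DN1) $\vdash_{\mathsf{G}}\alpha\Rightarrow\neg\neg\alpha$; ($\neg'$) if $\vdash_{\mathsf{G}}\alpha\cdot\beta\Rightarrow\gamma$ then $\vdash_{\mathsf{G}}\neg\gamma\cdot\beta\Rightarrow\neg\alpha$; (DN$\wedge$) $\vdash_{\mathsf{G}}\neg\neg(\neg\neg\alpha\wedge\neg\neg\beta)\Rightarrow\neg\neg\alpha\wedge\neg\neg\beta$ and $\vdash_{\mathsf{G}}\neg\neg\alpha\wedge\neg\neg\beta\Rightarrow\neg\neg(\neg\neg\alpha\wedge\neg\neg\beta)$; (Mon) if $\vdash_{\mathsf{G}}\alpha_1\Rightarrow\beta_1$ and $\vdash_{\mathsf{G}}\alpha_2\Rightarrow\beta_2$ then $\vdash_{\mathsf{G}}\alpha_1\cdot\alpha_2\Rightarrow\beta_1\cdot\beta_2$; (DN$\backslash$) $\vdash_{\mathsf{G}}\neg\neg(\neg\neg\alpha\backslash\neg\neg\beta)\Rightarrow\neg\neg\alpha\backslash\neg\neg\beta$ and $\vdash_{\mathsf{G}}\neg\neg\alpha\backslash\neg\neg\beta\Rightarrow\neg\neg(\neg\neg\alpha\backslash\neg\neg\beta)$.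
   Context: Formulas are built from propositional variables by $\alpha\cdot\beta$, $\alpha\backslash\beta$, $\alpha\wedge\beta$, $\alpha\vee\beta$, $\neg\alpha$; sequents are $\alpha\Rightarrow\beta$ with single formulas. The calculus $\mathsf{G}$ has axioms $(\mathrm{Id})\ \alpha\Rightarrow\alpha$ and $(\mathrm{DN2})\ \neg\neg\alpha\Rightarrow\alpha$, and the rules (premises / conclusion): $(\mathrm{RES}\backslash)$ $\alpha\cdot\beta\Rightarrow\gamma$ / $\beta\Rightarrow\alpha\backslash\gamma$; $(\mathrm{RES}^-\backslash)$ $\beta\Rightarrow\alpha\backslash\gamma$ / $\alpha\cdot\beta\Rightarrow\gamma$; $(\wedge\mathrm{L})$ $\alpha\Rightarrow\beta$ / $\alpha\wedge\gamma\Rightarrow\beta$ and $\alpha\Rightarrow\beta$ / $\gamma\wedge\alpha\Rightarrow\beta$; $(\wedge\mathrm{R})$ $\alpha\Rightarrow\beta$, $\alpha\Rightarrow\gamma$ / $\alpha\Rightarrow\beta\wedge\gamma$; $(\vee\mathrm{L})$ $\alpha\Rightarrow\beta$, $\gamma\Rightarrow\beta$ / $\alpha\vee\gamma\Rightarrow\beta$; $(\vee\mathrm{R})$ $\alpha\Rightarrow\beta$ / $\alpha\Rightarrow\beta\vee\gamma$ and $\alpha\Rightarrow\beta$ / $\alpha\Rightarrow\gamma\vee\beta$; $(\neg)$ $\alpha\cdot\beta\Rightarrow\neg\gamma$ / $\gamma\cdot\beta\Rightarrow\neg\alpha$, together with its special case $(\mathrm{MN})$ $\alpha\Rightarrow\neg\gamma$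 / $\gamma\Rightarrow\neg\alpha$; $(\mathrm{Cut})$ $\alpha\Rightarrow\beta$, $\beta\Rightarrow\gamma$ / $\alpha\Rightarrow\gamma$. -}

module Defs where

open import Data.Nat using (ℕ)
open import Data.Product using (_×_)

data Fm : Set where
  var  : ℕ → Fm
  _·_  : Fm → Fm → Fm
  _⟍_  : Fm → Fm → Fm
  _∧_  : Fm → Fm → Fm
  _∨_  : Fm → Fm → Fm
  ¬_   : Fm → Fm

infixr 30 ¬_
infixl 25 _·_
infixr 24 _⟍_
infixl 22 _∧_
infixl 21 _∨_

data Seq : Set where
  _⇒_ : Fm → Fm → Seq

infix 10 _⇒_

infix 5 ⊢_
data ⊢_ : Seq → Set where
  Id    : ∀ {α} → ⊢ α ⇒ α
  DN2   : ∀ {α} → ⊢ ¬ ¬ α ⇒ α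
  RES   : ∀ {α β γ} → ⊢ α · β ⇒ γ → ⊢ β ⇒ α ⟍ γ
  RES⁻  : ∀ {α β γ} → ⊢ β ⇒ α ⟍ γ → ⊢ α · β ⇒ γ
  ∧L₁   : ∀ {α β γ} → ⊢ α ⇒ β → ⊢ α ∧ γ ⇒ β
  ∧L₂   : ∀ {α β γ} → ⊢ α ⇒ β → ⊢ γ ∧ α ⇒ β
  ∧R    : ∀ {α β γ} → ⊢ α ⇒ β → ⊢ α ⇒ γ → ⊢ α ⇒ β ∧ γ
  ∨L    : ∀ {α β γ} → ⊢ α ⇒ β → ⊢ γ ⇒ β → ⊢ α ∨ γ ⇒ β
  ∨R₁   : ∀ {α β γ} → ⊢ α ⇒ β → ⊢ α ⇒ β ∨ γ
  ∨R₂   : ∀ {α β γ} → ⊢ α ⇒ β → ⊢ α ⇒ γ ∨ β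
  Neg   : ∀ {α β γ} → ⊢ α · β ⇒ ¬ γ → ⊢ γ · β ⇒ ¬ α
  MN    : ∀ {α γ} → ⊢ α ⇒ ¬ γ → ⊢ γ ⇒ ¬ α
  Cut   : ∀ {α β γ} → ⊢ α ⇒ β → ⊢ β ⇒ γ → ⊢ α ⇒ γ

{-# OPTIONS --safe #-}
module Submission where

open import Defs
open import Data.Product using (_×_; _,_)

¬¬-intro : ∀ {α} → ⊢ α ⇒ ¬ ¬ α
¬¬-intro = MN Id

contraposition : ∀ {α β} → ⊢ α ⇒ β → ⊢ ¬ β ⇒ ¬ α
contraposition d = MN (Cut d ¬¬-intro)

Neg′ : ∀ {α β γ} → ⊢ α · β ⇒ γ → ⊢ ¬ γ · β ⇒ ¬ α
Neg′ d = Neg (Cut d ¬¬-intro)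

·-monoʳ : ∀ {α β γ} → ⊢ α ⇒ β → ⊢ γ · α ⇒ γ · β
·-monoʳ d = RES⁻ (Cut d (RES Id))

-- G has only the residual ⟍ on the left factor, so monotonicity in that
-- factor is obtained by passing through negation with Neg′ and Neg.
·-monoˡ : ∀ {α β γ} → ⊢ α ⇒ β → ⊢ α · γ ⇒ β · γ
·-monoˡ d = Cut (Neg (Cut (Neg′ Id) (contraposition d))) DN2

·-mono : ∀ {α₁ α₂ β₁ β₂} → ⊢ α₁ ⇒ β₁ → ⊢ α₂ ⇒ β₂ → ⊢ α₁ · α₂ ⇒ β₁ · β₂
·-mono d₁ d₂ = Cut (·-monoˡ d₁) (·-monoʳ d₂)

mainTheorem2 : (α β γ α₁ α₂ β₁ β₂ : Fm)
    → (⊢ α ⇒ ¬ ¬ α)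
    × ((⊢ α · β ⇒ γ) → (⊢ ¬ γ · β ⇒ ¬ α))
    × ((⊢ ¬ ¬ (¬ ¬ α ∧ ¬ ¬ β) ⇒ ¬ ¬ α ∧ ¬ ¬ β) × (⊢ ¬ ¬ α ∧ ¬ ¬ β ⇒ ¬ ¬ (¬ ¬ α ∧ ¬ ¬ β)))
    × ((⊢ α₁ ⇒ β₁) → (⊢ α₂ ⇒ β₂) → (⊢ α₁ · α₂ ⇒ β₁ · β₂))
    × ((⊢ ¬ ¬ (¬ ¬ α ⟍ ¬ ¬ β) ⇒ ¬ ¬ α ⟍ ¬ ¬ β) × (⊢ ¬ ¬ α ⟍ ¬ ¬ β ⇒ ¬ ¬ (¬ ¬ α ⟍ ¬ ¬ β)))
mainTheorem2 _ _ _ _ _ _ _ =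
  ¬¬-intro , Neg′ , (DN2 , ¬¬-intro) , ·-mono , (DN2 , ¬¬-intro)
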